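{- Let $(V,\mathrm{dist})$ be a metric, $\rho>0$, and let $\mathcal{T}$ be a town decomposition of $V$ with hub sets $X_T$ as described in the context. Let $T\in\mathcal{T}$ and let $T'$ be a child town of $T$ with connecting hub $x\in X_T$. Then $\mathrm{dist}(x,T')\le (1+2\rho)\,\mathrm{dist}(T',V\setminus T')$.
   Context: A town decomposition is a laminar family $\mathcal{T}$ of subsets of $V$ (any two sets are disjoint or nested), whose members are called towns, such that $V\in\mathcal{T}$ and $\{v\}\in\mathcal{T}$ for every $v\in V$, and such that $\mathrm{diam}(T)<\mathrm{dist}(T,V\setminus T)$ for every $T\in\mathcal{T}$ (with $\mathrm{dist}(A,B)=\min_{a\in A,b\in B}\mathrm{dist}(a,b)$ and $\mathrm{diam}(A)=\max_{a,b\in A}\mathrm{dist}(a,b)$). The children of a town $T$ are the inclusion-wise maximal towns properly contained in $T$. Every town $T$ has a set of hubs $X_T\subseteq T$ with the property that for any two vertices $u,v$ lying in different child towns of $T$ there is $x\in X_T$ with $\mathrm{dist}(u,x)+\mathrm{dist}(x,v)\le (1+2\rho)\mathrm{dist}(u,v)$. For a child town $T'$ of $T$, its connecting hub is a fixed hub of $X_T$ closest to $T'$ (ties broken arbitrarily). -}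

module Defs where

open import Level using (Level; _⊔_) renaming (suc to lsuc)
open import Algebra.Bundles using (CommutativeRing)
open import Relation.Binary.Core using (Rel)
open import Relation.Binary.Structures using (IsTotalOrder)
open import Relation.Binary.PropositionalEquality using (_≡_; _≢_)
open import Relation.Nullary using (¬_)
open import Data.Product using (Σ; ∃; ∃-syntax; _×_; _,_)
open import Data.Sum using (_⊎_)
open import Data.Empty using (⊥)
open import Data.Nat using (ℕ)
open import Data.Fin using (Fin)
open import Data.Fin.Subset using (Subset; _∈_; _∉_; _⊆_; ⊤; ⁅_⁆; ∁)

-- Distance values: an ordered commutative ring (the reals are an
-- instance).  Only ring operations and a compatible total order are
-- used by the statement.

record OrderedCommRing (c ℓ₁ ℓ₂ : Level) : Set (lsuc (c ⊔ ℓ₁ ⊔ ℓ₂)) where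
  field
    commRing : CommutativeRing c ℓ₁
  open CommutativeRing commRing public
  infix 4 _≤_ _<_
  field
    _≤_          : Rel Carrier ℓ₂
    isTotalOrder : IsTotalOrder _≈_ _≤_
    +-monoˡ-≤    : ∀ {x y} z → x ≤ y → (x + z) ≤ (y + z)
    *-nonneg     : ∀ {x y} → 0# ≤ x → 0# ≤ y → 0# ≤ (x * y)

  _<_ : Rel Carrier (ℓ₁ ⊔ ℓ₂)
  x < y = (x ≤ y) × ¬ (x ≈ y)

module _ {c ℓ₁ ℓ₂ : Level} (R : OrderedCommRing c ℓ₁ ℓ₂) where
  open OrderedCommRing R

  record IsMetric {n : ℕ} (dist : Fin n → Fin n → Carrier) : Set (ℓ₁ ⊔ ℓ₂) where
    field
      dist-self  : ∀ x → dist x x ≈ 0#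
      dist-zero  : ∀ x y → dist x y ≈ 0# → x ≡ y
      dist-sym   : ∀ x y → dist x y ≈ dist y x
      dist-tri   : ∀ x y z → dist x z ≤ (dist x y + dist y z)

  module _ {n : ℕ} (dist : Fin n → Fin n → Carrier) where

    IsSetDist : Subset n → Subset n → Carrier → Set (ℓ₁ ⊔ ℓ₂)
    IsSetDist A B r =
      (∃[ a ] ∃[ b ] (a ∈ A × b ∈ B × dist a b ≈ r)) ×
      (∀ a b → a ∈ A → b ∈ B → r ≤ dist a b)

    IsDiam : Subset n → Carrier → Set (ℓ₁ ⊔ ℓ₂)
    IsDiam A r =
      (∃[ a ] ∃[ b ] (a ∈ A × b ∈ A × dist a b ≈ r)) ×
      (∀ a b → a ∈ A → b ∈ A → dist a b ≤ r)

    Disjoint : Subset n → Subset n → Set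
    Disjoint A B = ∀ x → x ∈ A → x ∈ B → ⊥

    IsChild : ∀ {ℓ} → (Subset n → Set ℓ) → Subset n → Subset n → Set ℓ
    IsChild Town T T' =
      Town T' × T' ⊆ T × T' ≢ T ×
      (∀ S → Town S → T' ⊆ S → S ⊆ T → (S ≡ T') ⊎ (S ≡ T))

    stretch : Carrier → Carrier
    stretch ρ = 1# + ((1# + 1#) * ρ)

    record IsTownDecomposition {ℓ} (Town : Subset n → Set ℓ) : Set (c ⊔ ℓ₁ ⊔ ℓ₂ ⊔ ℓ) where
      field
        laminar   : ∀ A B → Town A → Town B → Disjoint A B ⊎ (A ⊆ B ⊎ B ⊆ A)
        town-V    : Town ⊤
        town-sing : ∀ v → Town ⁅ v ⁆
        separated : ∀ T → Town T → ∀ r s →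
                    IsDiam T r → IsSetDist T (∁ T) s → r < s

    record IsHubSystem {ℓ} (Town : Subset n → Set ℓ) (ρ : Carrier)
                       (X : Subset n → Subset n) : Set (c ⊔ ℓ₁ ⊔ ℓ₂ ⊔ ℓ) where
      field
        hubs-in : ∀ T → Town T → X T ⊆ T
        hubs-ok : ∀ T → Town T → ∀ C C' → IsChild Town T C → IsChild Town T C' →
                  C ≢ C' → ∀ u v → u ∈ C → v ∈ C' →
                  ∃[ x ] (x ∈ X T × (dist u x + dist x v) ≤ (stretch ρ * dist u v))

    IsConnectingHub : (Subset n → Subset n) → Subset n → Subset n → Fin n → Set (c ⊔ ℓ₁ ⊔ ℓ₂)
    IsConnectingHub X T T' x =
      x ∈ X T ×
      (∀ y → y ∈ X T → ∀ r s → IsSetDist ⁅ x ⁆ T' r → IsSetDist ⁅ y ⁆ T' s → r ≤ s)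

module Submission where

-- We prove the stronger pointwise bound dist(x, T') ≤ (1 + 2ρ) · dist(u, v)
-- for every u ∈ T' and v ∉ T'; the theorem is the case where (u, v)
-- realises dist(T', V ∖ T').  Since x is a hub of T closest to T', it is
-- enough to exhibit some hub of T within (1 + 2ρ) · dist(u, v) of u:
--   * v ∉ T: then x itself works, because inside the town T all distances
--     are below dist(T, V ∖ T) ≤ dist(u, v) (towns are separated);
--   * v ∈ X_T: then v itself works;
--   * v ∈ T ∖ X_T: v lies in a child C ≠ T' of T, and the hub property of
--     T for the pair (u, v) provides a hub on a detour of length
--     ≤ (1 + 2ρ) · dist(u, v).
-- Children are maximal towns, and a maximal element of the (undecidable)
-- family of towns between {v} and T only exists up to double negation.
-- We therefore argue by totality of the order: if dist(x, T') were at least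
-- (1 + 2ρ) · dist(u, v), the detour hub would have to coincide with v, so v
-- is a hub after all (membership in X_T is decidable, so this is
-- constructive) and the second case applies.

open import Defs
open import Level using (Level)
open import Data.Nat using (ℕ; zero; suc)
open import Data.Fin using (Fin; zero; suc)
open import Data.Fin.Subset
  using (Subset; ∁; ⁅_⁆; _∈_; _∉_; _⊆_; _⊂_; _⊃_; Nonempty; Empty; inside; outside)
open import Data.Fin.Subset.Properties
  using (_∈?_; x∈⁅x⁆; x∈⁅y⁆⇒x≡y; x∈∁p⇒x∉p; x∉p⇒x∈∁p; ⊆-antisym; ⊆-trans)
open import Data.Fin.Subset.Induction using (Acc; acc; ⊃-wellFounded)
open import Data.Fin.Properties using (any?)
open import Data.Vec.Base using (_∷_; []; here; there)
open import Data.Vec.Properties using (≡-dec)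
open import Data.Bool.Properties using () renaming (_≟_ to _≟ᵇ_)
open import Data.Product using (∃; ∃-syntax; _×_; _,_; proj₁; proj₂)
open import Data.Sum using (_⊎_; inj₁; inj₂)
open import Data.Empty using (⊥-elim)
open import Function using (id; flip; _∘_)
open import Relation.Nullary using (¬_; yes; no; ¬?)
open import Relation.Nullary.Decidable using (_×-dec_; decidable-stable)
open import Relation.Binary.Core using (Rel)
open import Relation.Binary.Bundles using (Poset)
open import Relation.Binary.Definitions using (Total; Transitive; DecidableEquality)
open import Relation.Binary.Structures using (IsTotalOrder)
open import Relation.Binary.PropositionalEquality using (_≡_; _≢_; subst) renaming (sym to ≡-sym)
import Relation.Binary.Reasoning.PartialOrder as PosetReasoning

-- This yields set distances and
-- diameters, which the separation axiom of towns refers to.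
module Minimum {a ℓ} {A : Set a} (_≼_ : Rel A ℓ)
               (≼-total : Total _≼_) (≼-trans : Transitive _≼_) where

  ≼-refl : ∀ {x} → x ≼ x
  ≼-refl {x} with ≼-total x x
  ... | inj₁ x≼x = x≼x
  ... | inj₂ x≼x = x≼x

  IsMinimiser : ∀ {n} → (Fin n → A) → Subset n → Fin n → Set ℓ
  IsMinimiser f p a = a ∈ p × ∀ b → b ∈ p → f a ≼ f b

  empty-or-minimiser : ∀ {n} (f : Fin n → A) (p : Subset n) →
                       Empty p ⊎ ∃ (IsMinimiser f p)
  empty-or-minimiser {zero} f [] = inj₁ λ ()
  empty-or-minimiser {suc n} f (s ∷ p) with empty-or-minimiser (f ∘ suc) p | s
  ... | inj₁ empty | outside = inj₁ λ { (suc b , there b∈p) → empty (b , b∈p) }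
  ... | inj₁ empty | inside  =
        inj₂ (zero , here , λ { zero here → ≼-refl
                              ; (suc b) (there b∈p) → ⊥-elim (empty (b , b∈p)) })
  ... | inj₂ (a , a∈p , min) | outside =
        inj₂ (suc a , there a∈p , λ { (suc b) (there b∈p) → min b b∈p })
  ... | inj₂ (a , a∈p , min) | inside with ≼-total (f zero) (f (suc a))
  ...   | inj₁ head≼ =
          inj₂ (zero , here , λ { zero here → ≼-refl
                                ; (suc b) (there b∈p) → ≼-trans head≼ (min b b∈p) })
  ...   | inj₂ ≼head =
          inj₂ (suc a , there a∈p , λ { zero here → ≼head
                                      ; (suc b) (there b∈p) → min b b∈p })

  minimiser : ∀ {n} (f : Fin n → A) (p : Subset n) → Nonempty p → ∃ (IsMinimiser f p)
  minimiser f p nonempty with empty-or-minimiser f p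
  ... | inj₁ empty = ⊥-elim (empty nonempty)
  ... | inj₂ m     = m

  minimiser₂ : ∀ {n} (g : Fin n → Fin n → A) (P Q : Subset n) →
               Nonempty P → Nonempty Q →
               ∃[ a ] ∃[ b ] (a ∈ P × b ∈ Q × ∀ a' b' → a' ∈ P → b' ∈ Q → g a b ≼ g a' b')
  minimiser₂ g P Q neP neQ =
    let inner a = minimiser (g a) Q neQ
        (a , a∈P , outer) = minimiser (λ a → g a (proj₁ (inner a))) P neP
        (b , b∈Q , _) = inner a
    in a , b , a∈P , b∈Q ,
       λ a' b' a'∈P b'∈Q → ≼-trans (outer a' a'∈P) (proj₂ (proj₂ (inner a')) b' b'∈Q)

_≟ₛ_ : ∀ {n} → DecidableEquality (Subset n)
_≟ₛ_ = ≡-dec _≟ᵇ_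

⊆-≢⇒⊂ : ∀ {n} {p q : Subset n} → p ⊆ q → q ≢ p → p ⊂ q
⊆-≢⇒⊂ {p = p} {q} p⊆q q≢p with any? (λ z → (z ∈? q) ×-dec ¬? (z ∈? p))
... | yes (z , z∈q , z∉p) = p⊆q , z , z∈q , z∉p
... | no none = ⊥-elim (q≢p (⊆-antisym q⊆p p⊆q))
  where
    q⊆p : q ⊆ p
    q⊆p {z} z∈q = decidable-stable (z ∈? p) (λ z∉p → none (z , z∈q , z∉p))

module OrderedRingFacts {c ℓ₁ ℓ₂ : Level} (R : OrderedCommRing c ℓ₁ ℓ₂) where
  open OrderedCommRing R public
  open IsTotalOrder isTotalOrder public
    using (antisym; total; ≤-respʳ-≈)
    renaming (trans to ≤-trans)

  poset : Poset c ℓ₁ ℓ₂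
  poset = record { isPartialOrder = IsTotalOrder.isPartialOrder isTotalOrder }

  module ≤-Reasoning = PosetReasoning poset

  open ≤-Reasoning

  x≤x+y : ∀ {x y} → 0# ≤ y → x ≤ x + y
  x≤x+y {x} {y} 0≤y = begin
    x       ≈⟨ sym (+-identityˡ x) ⟩
    0# + x  ≤⟨ +-monoˡ-≤ x 0≤y ⟩
    y + x   ≈⟨ +-comm y x ⟩
    x + y   ∎

  x+y≤x⇒y≤0 : ∀ {x y} → x + y ≤ x → y ≤ 0#
  x+y≤x⇒y≤0 {x} {y} x+y≤x = begin
    y                ≈⟨ sym (+-identityʳ y) ⟩
    y + 0#           ≈⟨ +-congˡ (sym (-‿inverseʳ x)) ⟩
    y + (x + - x)    ≈⟨ sym (+-assoc y x (- x)) ⟩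
    (y + x) + - x    ≈⟨ +-congʳ (+-comm y x) ⟩
    (x + y) + - x    ≤⟨ +-monoˡ-≤ (- x) x+y≤x ⟩
    x + - x          ≈⟨ -‿inverseʳ x ⟩
    0#               ∎

  x≤[1+a]*x : ∀ {a x} → 0# ≤ a → 0# ≤ x → x ≤ (1# + a) * x
  x≤[1+a]*x {a} {x} 0≤a 0≤x = begin
    x              ≤⟨ x≤x+y (*-nonneg 0≤a 0≤x) ⟩
    x + a * x      ≈⟨ +-congʳ (sym (*-identityˡ x)) ⟩
    1# * x + a * x ≈⟨ sym (distribʳ x 1# a) ⟩
    (1# + a) * x   ∎

  0≤2*x : ∀ {x} → 0# ≤ x → 0# ≤ (1# + 1#) * x
  0≤2*x {x} 0≤x = begin
    0#              ≤⟨ 0≤x ⟩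
    x               ≤⟨ x≤x+y 0≤x ⟩
    x + x           ≈⟨ sym (+-cong (*-identityˡ x) (*-identityˡ x)) ⟩
    1# * x + 1# * x ≈⟨ sym (distribʳ x 1# 1#) ⟩
    (1# + 1#) * x   ∎

module MetricFacts {c ℓ₁ ℓ₂ : Level} (R : OrderedCommRing c ℓ₁ ℓ₂) {n : ℕ}
                   {dist : Fin n → Fin n → OrderedCommRing.Carrier R}
                   (metric : IsMetric R dist) where
  open OrderedRingFacts R
  open IsMetric metric
  open ≤-Reasoning

  -- Nonnegativity, from 0 = dist(a, a) ≤ 2 · dist(a, b).
  dist-nonneg : ∀ a b → 0# ≤ dist a b
  dist-nonneg a b with total 0# (dist a b)
  ... | inj₁ 0≤d = 0≤d
  ... | inj₂ d≤0 = begin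
    0#                    ≈⟨ sym (dist-self a) ⟩
    dist a a              ≤⟨ dist-tri a b a ⟩
    dist a b + dist b a   ≈⟨ +-congˡ (dist-sym b a) ⟩
    dist a b + dist a b   ≤⟨ +-monoˡ-≤ (dist a b) d≤0 ⟩
    0# + dist a b         ≈⟨ +-identityˡ (dist a b) ⟩
    dist a b              ∎

  ≤-stretch : ∀ {ρ d} → 0# ≤ ρ → 0# ≤ d → d ≤ stretch R dist ρ * d
  ≤-stretch 0≤ρ 0≤d = x≤[1+a]*x (0≤2*x 0≤ρ) 0≤d

  detour-collapse : ∀ {u y v} → dist u y + dist y v ≤ dist y u → y ≡ v
  detour-collapse {u} {y} {v} tight =
    dist-zero y v (antisym dist≤0 (dist-nonneg y v))
    where
      dist≤0 : dist y v ≤ 0#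
      dist≤0 = x+y≤x⇒y≤0 (≤-respʳ-≈ (dist-sym y u) tight)

  module Min = Minimum _≤_ total ≤-trans
  module Max = Minimum (flip _≤_) (flip total) (flip ≤-trans)

  setDist-exists : ∀ {A B} → Nonempty A → Nonempty B → ∃ (IsSetDist R dist A B)
  setDist-exists {A} {B} neA neB =
    let (a , b , a∈A , b∈B , min) = Min.minimiser₂ dist A B neA neB
    in dist a b , (a , b , a∈A , b∈B , refl) , min

  diam-exists : ∀ {A} → Nonempty A → ∃ (IsDiam R dist A)
  diam-exists {A} neA =
    let (a , b , a∈A , b∈A , max) = Max.minimiser₂ dist A A neA neA
    in dist a b , (a , b , a∈A , b∈A , refl) , max

-- Every town properly contained in T lies in some child of T, up to double
-- negation: the child is a maximal town between it and T, and maximality is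
-- not decidable for an arbitrary family of towns.  Proof by well-founded
-- induction along strict supersets: if no child contained S, then S itself
-- would be maximal, hence a child.
module Children {c ℓ₁ ℓ₂ ℓ : Level} (R : OrderedCommRing c ℓ₁ ℓ₂) {n : ℕ}
                (dist : Fin n → Fin n → OrderedCommRing.Carrier R)
                (Town : Subset n → Set ℓ) where

  InChild : Subset n → Subset n → Set ℓ
  InChild T S = ∃[ C ] (IsChild R dist Town T C × S ⊆ C)

  subtown-in-child : ∀ {T} S → Town S → S ⊆ T → S ≢ T → ¬ ¬ InChild T S
  subtown-in-child {T} S = go S (⊃-wellFounded S)
    where
      go : ∀ S → Acc _⊃_ S → Town S → S ⊆ T → S ≢ T → ¬ ¬ InChild T S
      go S (acc larger) townS S⊆T S≢T noChild =
        noChild (S , (townS , S⊆T , S≢T , maximal) , id)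
        where
          maximal : ∀ S' → Town S' → S ⊆ S' → S' ⊆ T → (S' ≡ S) ⊎ (S' ≡ T)
          maximal S' townS' S⊆S' S'⊆T with S' ≟ₛ S | S' ≟ₛ T
          ... | yes S'≡S | _        = inj₁ S'≡S
          ... | no _     | yes S'≡T = inj₂ S'≡T
          ... | no S'≢S  | no S'≢T  =
            ⊥-elim (go S' (larger (⊆-≢⇒⊂ S⊆S' S'≢S)) townS' S'⊆T S'≢T
                      λ (C , childC , S'⊆C) → noChild (C , childC , ⊆-trans S⊆S' S'⊆C))

module HubArgument {c ℓ₁ ℓ₂ ℓ : Level} (R : OrderedCommRing c ℓ₁ ℓ₂) {n : ℕ}
                   {dist : Fin n → Fin n → OrderedCommRing.Carrier R}
                   (metric : IsMetric R dist)
                   {Town : Subset n → Set ℓ}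
                   (decomposition : IsTownDecomposition R dist Town)
                   (ρ : OrderedCommRing.Carrier R) {X : Subset n → Subset n}
                   (hubs : IsHubSystem R dist Town ρ X) where
  open OrderedRingFacts R
  open MetricFacts R metric
  open IsMetric metric using (dist-sym)
  open IsTownDecomposition decomposition
  open IsHubSystem hubs
  open Children R dist Town
  open ≤-Reasoning

  -- Inside a town every distance is at most the distance from any of its
  -- points to any point outside: diam(T) < dist(T, V ∖ T).
  town-separates : ∀ {T a b e} → Town T → a ∈ T → b ∈ T → e ∉ T → dist a b ≤ dist b e
  town-separates {T} {a} {b} {e} townT a∈T b∈T e∉T =
    let (D , diamD) = diam-exists (a , a∈T)
        (σ , sepσ) = setDist-exists (b , b∈T) (e , x∉p⇒x∈∁p e∉T)
    in begin
      dist a b  ≤⟨ proj₂ diamD a b a∈T b∈T ⟩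
      D         ≤⟨ proj₁ (separated T townT D σ diamD sepσ) ⟩
      σ         ≤⟨ proj₂ sepσ b e b∈T (x∉p⇒x∈∁p e∉T) ⟩
      dist b e  ∎

  connecting-hub-nearest : ∀ {T T' x r y t} → IsConnectingHub R dist X T T' x →
                           IsSetDist R dist ⁅ x ⁆ T' r → y ∈ X T → t ∈ T' → r ≤ dist y t
  connecting-hub-nearest {y = y} {t} (_ , closest) r-is y∈X t∈T' =
    let (σ , σ-is) = setDist-exists (y , x∈⁅x⁆ y) (t , t∈T')
    in ≤-trans (closest y y∈X _ σ r-is σ-is) (proj₂ σ-is y t (x∈⁅x⁆ y) t∈T')

  -- Let u ∈ T' and v ∈ T ∖ T'.  If every hub of T is at distance at least
  -- (1 + 2ρ) · dist(u, v) from u, then v is a hub of T: v lies in a child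
  -- C ≠ T', and the hub provided for the pair (u, v) must collapse onto v.
  remote-hubs⇒hub : ∀ {T T' u v} → Town T → IsChild R dist Town T T' →
                    u ∈ T' → v ∈ T → v ∉ T' →
                    (∀ y → y ∈ X T → stretch R dist ρ * dist u v ≤ dist y u) → v ∈ X T
  remote-hubs⇒hub {T} {T'} {u} {v} townT childT' u∈T' v∈T v∉T' remote =
    decidable-stable (v ∈? X T) λ v∉X →
      subtown-in-child ⁅ v ⁆ (town-sing v) ⁅v⁆⊆T ⁅v⁆≢T λ (C , childC , ⁅v⁆⊆C) →
        let v∈C = ⁅v⁆⊆C (x∈⁅x⁆ v)
            T'≢C : T' ≢ C
            T'≢C T'≡C = v∉T' (subst (v ∈_) (≡-sym T'≡C) v∈C)
            (y , y∈X , detour) = hubs-ok T townT T' C childT' childC T'≢C u v u∈T' v∈C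
        in v∉X (subst (_∈ X T) (detour-collapse (≤-trans detour (remote y y∈X))) y∈X)
    where
      ⁅v⁆⊆T : ⁅ v ⁆ ⊆ T
      ⁅v⁆⊆T z∈⁅v⁆ = subst (_∈ T) (≡-sym (x∈⁅y⁆⇒x≡y v z∈⁅v⁆)) v∈T

      -- T contains u ≠ v
      ⁅v⁆≢T : ⁅ v ⁆ ≢ T
      ⁅v⁆≢T ⁅v⁆≡T =
        let u∈⁅v⁆ = subst (u ∈_) (≡-sym ⁅v⁆≡T) (proj₁ (proj₂ childT') u∈T')
        in v∉T' (subst (_∈ T') (x∈⁅y⁆⇒x≡y v u∈⁅v⁆) u∈T')

  connecting-hub-bound : ∀ {T T' x r u v} → 0# ≤ ρ → Town T → IsChild R dist Town T T' →
                         IsConnectingHub R dist X T T' x → IsSetDist R dist ⁅ x ⁆ T' r →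
                         u ∈ T' → v ∉ T' → r ≤ stretch R dist ρ * dist u v
  connecting-hub-bound {T} {T'} {x} {r} {u} {v} 0≤ρ townT childT' conn r-is u∈T' v∉T'
    with v ∈? T
  ... | no v∉T = begin
    r                 ≤⟨ connecting-hub-nearest conn r-is (proj₁ conn) u∈T' ⟩
    dist x u          ≤⟨ town-separates townT (hubs-in T townT (proj₁ conn))
                                        (proj₁ (proj₂ childT') u∈T') v∉T ⟩
    dist u v          ≤⟨ ≤-stretch 0≤ρ (dist-nonneg u v) ⟩
    stretch R dist ρ * dist u v ∎
  ... | yes v∈T with total r (stretch R dist ρ * dist u v)
  ...   | inj₁ r≤bound = r≤bound
  ...   | inj₂ bound≤r = begin
    r                 ≤⟨ connecting-hub-nearest conn r-is v∈X u∈T' ⟩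
    dist v u          ≈⟨ dist-sym v u ⟩
    dist u v          ≤⟨ ≤-stretch 0≤ρ (dist-nonneg u v) ⟩
    stretch R dist ρ * dist u v ∎
    where
      v∈X : v ∈ X T
      v∈X = remote-hubs⇒hub townT childT' u∈T' v∈T v∉T'
              λ y y∈X → ≤-trans bound≤r (connecting-hub-nearest conn r-is y∈X u∈T')

lemma3p1 : ∀ {c ℓ₁ ℓ₂ ℓ : Level} (R : OrderedCommRing c ℓ₁ ℓ₂) {n : ℕ}
             (dist : Fin n → Fin n → OrderedCommRing.Carrier R) →
             IsMetric R dist →
             (ρ : OrderedCommRing.Carrier R) → OrderedCommRing._<_ R (OrderedCommRing.0# R) ρ →
             (Town : Subset n → Set ℓ) → IsTownDecomposition R dist Town →
             (X : Subset n → Subset n) → IsHubSystem R dist Town ρ X →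
             (T T' : Subset n) → Town T → IsChild R dist Town T T' →
             (x : Fin n) → IsConnectingHub R dist X T T' x →
             ∀ r s → IsSetDist R dist ⁅ x ⁆ T' r → IsSetDist R dist T' (∁ T') s →
             OrderedCommRing._≤_ R r (OrderedCommRing._*_ R (stretch R dist ρ) s)
lemma3p1 R dist metric ρ 0<ρ Town decomposition X hubs T T' townT childT' x conn r s r-is
         ((u , v , u∈T' , v∈∁T' , duv≈s) , _) =
  ≤-respʳ-≈ (*-congˡ duv≈s)
    (connecting-hub-bound (proj₁ 0<ρ) townT childT' conn r-is u∈T' (x∈∁p⇒x∉p v∈∁T'))
  where
    open OrderedRingFacts R
    open HubArgument R metric decomposition ρ hubs
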